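{- Let $p$ be a prime. For every integer $n\ge p+1$, $$\lambda_p(n)=\sum_{i=1}^p\lambda_p\bigl(n-i+1-\lambda_p(n-i)\bigr).$$
   Context: For $\vec v\in\mathbb{F}_p^n$, $\|\vec v\|$ denotes the number of nonzero coordinates. For a matrix $M$ over $\mathbb{F}_p$, its capacity is $c(M)=\max_{\vec v\in \mathrm{row}(M)}\|\vec v\|$, where $\mathrm{row}(M)$ is the $\mathbb{F}_p$-span of its rows. For $n\ge1$, $\mathcal{M}_n^*$ is the set of $m\times n$ matrices over $\mathbb{F}_p$ with $1\le m\le p^n$ and no zero column, and $\lambda_p(n)=\min_{M\in\mathcal{M}_n^*} c(M)$. -}

module Defs where

open import Data.Nat using (ℕ; zero; suc; _+_; _*_; _∸_; _^_; _≤_; NonZero)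
open import Data.Nat.DivMod using (_mod_)
open import Data.Nat.Primality using (Prime; prime⇒nonZero)
open import Data.Fin using (Fin; toℕ) renaming (zero to fzero)
open import Data.Nat.Properties using (_≟_)
open import Data.List using (List; length; filter; map; allFin)
open import Data.Nat.ListAction using (sum)
open import Data.Product using (Σ; ∃; _×_; _,_)
open import Relation.Nullary using (¬_; ¬?)
open import Relation.Binary.PropositionalEquality using (_≡_; _≢_)

∑ : (m : ℕ) → (Fin m → ℕ) → ℕ
∑ m f = sum (map f (allFin m))

module _ {p : ℕ} (pp : Prime p) where
  private instance
    nz : NonZero p
    nz = prime⇒nonZero pp

  𝔽 : Set
  𝔽 = Fin p

  -- m × n matrix over 𝔽_p (entry i j = row i, column j).
  Matrix : ℕ → ℕ → Set
  Matrix m n = Fin m → Fin n → 𝔽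

  lincomb : ∀ {m n} → Matrix m n → (Fin m → 𝔽) → Fin n → 𝔽
  lincomb {m} M a j = (∑ m (λ i → toℕ (a i) * toℕ (M i j))) mod p

  InRow : ∀ {m n} → Matrix m n → (Fin n → 𝔽) → Set
  InRow {m} M v = Σ (Fin m → 𝔽) (λ a → ∀ j → lincomb M a j ≡ v j)

  weight : ∀ {n} → (Fin n → 𝔽) → ℕ
  weight {n} v = length (filter (λ j → ¬? (toℕ (v j) ≟ 0)) (allFin n))

  IsCapacity : ∀ {m n} → Matrix m n → ℕ → Set
  IsCapacity M c = (Σ _ λ v → InRow M v × weight v ≡ c)
                 × (∀ v → InRow M v → weight v ≤ c)

  NoZeroColumn : ∀ {m n} → Matrix m n → Set
  NoZeroColumn {m} {n} M = ∀ (j : Fin n) → Σ (Fin m) λ i → toℕ (M i j) ≢ 0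

  InMStar : ∀ m n → Matrix m n → Set
  InMStar m n M = (1 ≤ m) × (m ≤ p ^ n) × NoZeroColumn M

  IsLambda : ℕ → ℕ → Set
  IsLambda n k =
      (Σ ℕ λ m → Σ (Matrix m n) λ M → InMStar m n M × IsCapacity M k)
    × (∀ m (M : Matrix m n) → InMStar m n M → ∀ c → IsCapacity M c → k ≤ c)

-- λ_p(n) is the least k with n ≤ N k, where N k = Σ_{j ≥ 0} ⌊k / pʲ⌋.
-- Lower bound (Griesmer): let b maximise the weight w of the codeword b G. Averaging the
-- weights of (a + α b) G over α ∈ 𝔽_p shows that the columns of G in the kernel of b form a
-- code all of whose weights are at most w / p, so by induction n ≤ w + N (w / p) = N w.
-- Upper bound: the direct sum of simplex codes of PG(i, p), taken as often as the i-th base-p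
-- digit of k, has length N k and all weights at most k.
-- The recurrence is then a count: λ n = #{k | N k < n}. Writing k = q p + i with i < p gives
-- N k = N (q p) + i, and for m = n - i - 1 one has N (q p) ≤ m iff q < λ (m + 1 - λ m).

module Submission where

open import Defs
open import Data.Nat
  using ( ℕ; zero; suc; _+_; _*_; _∸_; _^_; _⊓_; pred; _%_; _/_; _≤_; _<_; z≤n; z<s; s≤s; s≤s⁻¹
        ; NonZero; ≢-nonZero; >-nonZero⁻¹; _≟_; _<?_)
open import Data.Nat.Properties
open import Data.Nat.DivMod
open import Data.Nat.Tactic.RingSolver using (solve-∀)
open import Data.Nat.Divisibility using (_∣_; _∣?_; divides; n∣m*n; m%n≡0⇒n∣m; n∣m⇒m%n≡0; >⇒∤; ∣m+n∣m⇒∣n)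
open import Data.Nat.Primality using (Prime; euclidsLemma; ¬prime[0]; ¬prime[1])
open import Data.Nat.Coprimality using (coprime-Bézout; prime⇒coprime)
open import Data.Nat.GCD using (module Bézout)
import Data.Nat.ListAction as List
import Data.Nat.ListAction.Properties as List
open import Algebra.Properties.CommutativeSemigroup +-commutativeSemigroup using (xy∙z≈xz∙y; x∙yz≈y∙xz)
open import Algebra.Properties.CommutativeMonoid.Sum +-0-commutativeMonoid
  using (sum; sum-cong-≗; ∑-distrib-+; sum-replicate-zero)
open import Data.Fin using (Fin; toℕ; _↑ˡ_; _↑ʳ_) renaming (zero to fzero; suc to fsuc)
open import Data.Fin.Properties as Fin using (toℕ<n; toℕ-fromℕ<; toℕ-injective; any?)
open import Data.List
  using (List; []; _∷_; _++_; map; concat; tabulate; replicate; take; length; filter; lookup; allFin)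
open import Data.List.Relation.Unary.All as All using (All; []; _∷_)
open import Data.List.Relation.Unary.All.Properties using (filter⁺; ++⁺; map⁺; tabulate⁺; take⁺)
open import Data.List.Membership.Propositional.Properties using (∈-lookup)
open import Data.List.Properties
  using ( map-tabulate; map-∘; map-cong; map-++; concat-map; tabulate-lookup; take-map; filter-accept; filter-reject
        ; length-replicate; length-tabulate; length-take; length-map; length-++)
open import Data.Product using (Σ; ∃; _×_; _,_; proj₁; proj₂)
open import Data.Vec.Functional as V using (Vector)
open import Data.Sum using (inj₁; inj₂; [_,_]′)
open import Relation.Nullary using (¬_; ¬?; Dec; yes; no; contradiction)
open import Relation.Nullary.Decidable using (decidable-stable)
open import Relation.Binary.PropositionalEquality
open import Function.Properties.Equivalence using () renaming (sym to ⇔-sym; trans to ⇔-trans)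
open import Function using (_∘_; id; case_of_; _⇔_; mk⇔; Equivalence)

sum-mono-≤ : ∀ {n} {f g : Fin n → ℕ} → (∀ i → f i ≤ g i) → sum f ≤ sum g
sum-mono-≤ {zero} _ = z≤n
sum-mono-≤ {suc n} f≤g = +-mono-≤ (f≤g fzero) (sum-mono-≤ (f≤g ∘ fsuc))

sum-const : ∀ n c → sum {n} (λ _ → c) ≡ n * c
sum-const zero c = refl
sum-const (suc n) c = cong (c +_) (sum-const n c)

sum-*ˡ : ∀ {n} c (f : Fin n → ℕ) → sum (λ i → c * f i) ≡ c * sum f
sum-*ˡ {zero} c f = sym (*-zeroʳ c)
sum-*ˡ {suc n} c f =
  trans (cong (c * f fzero +_) (sum-*ˡ c (f ∘ fsuc))) (sym (*-distribˡ-+ c _ _))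

sum-tabulate : ∀ {n} (f : Fin n → ℕ) → List.sum (tabulate f) ≡ sum f
sum-tabulate {zero} f = refl
sum-tabulate {suc n} f = cong (f fzero +_) (sum-tabulate (f ∘ fsuc))

∑≡sum : ∀ n (f : Fin n → ℕ) → ∑ n f ≡ sum f
∑≡sum n f = trans (cong List.sum (map-tabulate id f)) (sum-tabulate f)

sum-toℕ-++ : ∀ m n (h : ℕ → ℕ) →
             sum {m + n} (h ∘ toℕ) ≡ sum {m} (h ∘ toℕ) + sum {n} (λ i → h (m + toℕ i))
sum-toℕ-++ zero n h = refl
sum-toℕ-++ (suc m) n h =
  trans (cong (h 0 +_) (sum-toℕ-++ m n (h ∘ suc))) (sym (+-assoc (h 0) _ _))

sum-toℕ-blocks : ∀ b p (h : ℕ → ℕ) →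
                 sum {b * p} (h ∘ toℕ) ≡ sum {p} (λ i → sum {b} (λ j → h (toℕ j * p + toℕ i)))
sum-toℕ-blocks zero p h = sym (sum-replicate-zero p)
sum-toℕ-blocks (suc b) p h = begin
  sum {p + b * p} (h ∘ toℕ)
    ≡⟨ sum-toℕ-++ p (b * p) h ⟩
  sum {p} (h ∘ toℕ) + sum {b * p} (λ k → h (p + toℕ k))
    ≡⟨ cong (sum {p} (h ∘ toℕ) +_) (sum-toℕ-blocks b p (h ∘ (p +_))) ⟩
  sum {p} (h ∘ toℕ) + sum {p} (λ i → sum {b} (λ j → h (p + (toℕ j * p + toℕ i))))
    ≡⟨ sym (∑-distrib-+ {p} (h ∘ toℕ) _) ⟩
  sum {p} (λ i → h (toℕ i) + sum {b} (λ j → h (p + (toℕ j * p + toℕ i))))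
    ≡⟨ sum-cong-≗ {p} (λ i → cong (h (toℕ i) +_)
         (sum-cong-≗ {b} (λ j → cong h (sym (+-assoc p (toℕ j * p) (toℕ i)))))) ⟩
  sum {p} (λ i → sum {suc b} (λ j → h (toℕ j * p + toℕ i))) ∎
  where open ≡-Reasoning

𝟙 : ∀ {a} {A : Set a} → Dec A → ℕ
𝟙 (yes _) = 1
𝟙 (no _) = 0

𝟙-cong : ∀ {a b} {A : Set a} {B : Set b} → A ⇔ B → (A? : Dec A) (B? : Dec B) → 𝟙 A? ≡ 𝟙 B?
𝟙-cong A⇔B (yes _) (yes _) = refl
𝟙-cong A⇔B (no _) (no _) = refl
𝟙-cong A⇔B (yes a) (no ¬b) = contradiction (Equivalence.to A⇔B a) ¬b
𝟙-cong A⇔B (no ¬a) (yes b) = contradiction (Equivalence.from A⇔B b) ¬a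

count-< : ∀ {t} b → t ≤ b → sum {b} (λ j → 𝟙 (toℕ j <? t)) ≡ t
count-< {zero} b _ = trans (sum-cong-≗ {b} (λ j → refl)) (sum-replicate-zero b)
count-< {suc t} (suc b) (s≤s t≤b) = cong suc (begin
  sum {b} (λ j → 𝟙 (suc (toℕ j) <? suc t)) ≡⟨ sum-cong-≗ {b} (λ j → 𝟙-cong (mk⇔ s≤s⁻¹ s≤s) _ _) ⟩
  sum {b} (λ j → 𝟙 (toℕ j <? t))           ≡⟨ count-< b t≤b ⟩
  t                                         ∎)
  where open ≡-Reasoning

sum-concat : (xss : List (List ℕ)) → List.sum (concat xss) ≡ List.sum (map List.sum xss)
sum-concat [] = refl
sum-concat (xs ∷ xss) = trans (List.sum-++ xs (concat xss)) (cong (List.sum xs +_) (sum-concat xss))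

sum-map-mono-≤ : ∀ {A : Set} {f g : A → ℕ} → (∀ x → f x ≤ g x) → ∀ xs → List.sum (map f xs) ≤ List.sum (map g xs)
sum-map-mono-≤ f≤g [] = z≤n
sum-map-mono-≤ f≤g (x ∷ xs) = +-mono-≤ (f≤g x) (sum-map-mono-≤ f≤g xs)

length≡sum-map-1 : ∀ {A : Set} (xs : List A) → length xs ≡ List.sum (map (λ _ → 1) xs)
length≡sum-map-1 [] = refl
length≡sum-map-1 (x ∷ xs) = cong suc (length≡sum-map-1 xs)

sum-map-*ˡ : ∀ {A : Set} c (f : A → ℕ) xs → List.sum (map (λ x → c * f x) xs) ≡ c * List.sum (map f xs)
sum-map-*ˡ c f [] = sym (*-zeroʳ c)
sum-map-*ˡ c f (x ∷ xs) = trans (cong (c * f x +_) (sum-map-*ˡ c f xs)) (sym (*-distribˡ-+ c (f x) _))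

sum-map-replicate : ∀ {A : Set} (f : A → ℕ) r x → List.sum (map f (replicate r x)) ≡ r * f x
sum-map-replicate f zero x = refl
sum-map-replicate f (suc r) x = cong (f x +_) (sum-map-replicate f r x)

sum-take-≤ : ∀ n xs → List.sum (take n xs) ≤ List.sum xs
sum-take-≤ zero xs = z≤n
sum-take-≤ (suc n) [] = z≤n
sum-take-≤ (suc n) (x ∷ xs) = +-monoʳ-≤ x (sum-take-≤ n xs)

length-filter-𝟙 : ∀ {A : Set} {P : A → Set} (P? : ∀ x → Dec (P x)) xs →
                  length (filter P? xs) ≡ List.sum (map (𝟙 ∘ P?) xs)
length-filter-𝟙 P? [] = refl
length-filter-𝟙 P? (x ∷ xs) with P? x
... | yes _ = cong suc (length-filter-𝟙 P? xs)
... | no _ = length-filter-𝟙 P? xs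

sum-map-digit-step : ∀ (g : ℕ → ℕ) r B →
                     List.sum (map g (replicate r 0 ++ map suc B)) ≡ r * g 0 + List.sum (map (g ∘ suc) B)
sum-map-digit-step g r B = begin
  List.sum (map g (replicate r 0 ++ map suc B))
    ≡⟨ cong List.sum (map-++ g (replicate r 0) (map suc B)) ⟩
  List.sum (map g (replicate r 0) ++ map g (map suc B))
    ≡⟨ List.sum-++ (map g (replicate r 0)) _ ⟩
  List.sum (map g (replicate r 0)) + List.sum (map g (map suc B))
    ≡⟨ cong₂ _+_ (sum-map-replicate g r 0) (cong List.sum (sym (map-∘ B))) ⟩
  r * g 0 + List.sum (map (g ∘ suc) B) ∎
  where open ≡-Reasoning

-- N k = k + v_p(k!); the fuel k suffices since ⌊k / pʲ⌋ = 0 for j ≥ k.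
module FloorSum (p : ℕ) .{{_ : NonZero p}} (1<p : 1 < p) where

  N-fuel : ℕ → ℕ → ℕ
  N-fuel zero k = 0
  N-fuel (suc f) k = k + N-fuel f (k / p)

  N : ℕ → ℕ
  N k = N-fuel k k

  /p-≤ : ∀ {k f} → k ≤ suc f → k / p ≤ f
  /p-≤ {zero} _ = ≤-trans (≤-reflexive (0/n≡0 p)) z≤n
  /p-≤ {suc k} k≤1+f = s≤s⁻¹ (≤-trans (m/n<m (suc k) p 1<p) k≤1+f)

  N-fuel-0 : ∀ f → N-fuel f 0 ≡ 0
  N-fuel-0 zero = refl
  N-fuel-0 (suc f) = trans (cong (N-fuel f) (0/n≡0 p)) (N-fuel-0 f)

  N-fuel-stable : ∀ {f g k} → k ≤ f → k ≤ g → N-fuel f k ≡ N-fuel g k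
  N-fuel-stable {zero} {g} z≤n _ = sym (N-fuel-0 g)
  N-fuel-stable {suc f} {zero} _ z≤n = N-fuel-0 (suc f)
  N-fuel-stable {suc f} {suc g} {k} k≤f k≤g = cong (k +_) (N-fuel-stable (/p-≤ k≤f) (/p-≤ k≤g))

  N-fuel-mono : ∀ f {a b} → a ≤ b → N-fuel f a ≤ N-fuel f b
  N-fuel-mono zero _ = z≤n
  N-fuel-mono (suc f) a≤b = +-mono-≤ a≤b (N-fuel-mono f (/-monoˡ-≤ p a≤b))

  N-unfold : ∀ k → N k ≡ k + N (k / p)
  N-unfold zero = cong N (sym (0/n≡0 p))
  N-unfold (suc k) = cong (suc k +_) (N-fuel-stable (/p-≤ ≤-refl) (≤-refl {suc k / p}))

  N-*p : ∀ q → N (q * p) ≡ q * p + N q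
  N-*p q = trans (N-unfold (q * p)) (cong (λ z → q * p + N z) (m*n/n≡m q p))

  N-block : ∀ q {i} → i < p → N (q * p + i) ≡ N (q * p) + i
  N-block q {i} i<p = begin
    N (q * p + i)                   ≡⟨ N-unfold (q * p + i) ⟩
    q * p + i + N ((q * p + i) / p) ≡⟨ cong (λ z → q * p + i + N z) block/p ⟩
    q * p + i + N q                 ≡⟨ xy∙z≈xz∙y (q * p) i (N q) ⟩
    q * p + N q + i                 ≡⟨ cong (_+ i) (N-*p q) ⟨
    N (q * p) + i                   ∎
    where
    open ≡-Reasoning
    block/p : (q * p + i) / p ≡ q
    block/p = begin
      (q * p + i) / p   ≡⟨ +-distrib-/-∣ˡ i (n∣m*n q) ⟩
      q * p / p + i / p ≡⟨ cong₂ _+_ (m*n/n≡m q p) (m<n⇒m/n≡0 i<p) ⟩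
      q + 0             ≡⟨ +-identityʳ q ⟩
      q                 ∎

  N-mono-≤ : ∀ {a b} → a ≤ b → N a ≤ N b
  N-mono-≤ {a} {b} a≤b = ≤-trans (≤-reflexive (N-fuel-stable ≤-refl a≤b)) (N-fuel-mono b a≤b)

  N-<-suc : ∀ k → N k < N (suc k)
  N-<-suc k = begin-strict
    N k                   ≡⟨ N-unfold k ⟩
    k + N (k / p)         <⟨ +-monoˡ-< (N (k / p)) ≤-refl ⟩
    suc k + N (k / p)     ≤⟨ +-monoʳ-≤ (suc k) (N-mono-≤ (/-monoˡ-≤ p (n≤1+n k))) ⟩
    suc k + N (suc k / p) ≡⟨ N-unfold (suc k) ⟨
    N (suc k)             ∎
    where open ≤-Reasoning

  N-mono-< : ∀ {a b} → a < b → N a < N b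
  N-mono-< {a} a<b = <-≤-trans (N-<-suc a) (N-mono-≤ a<b)

  N-cancel-≤ : ∀ {a b} → N a ≤ N b → a ≤ b
  N-cancel-≤ Na≤Nb = ≮⇒≥ (λ b<a → <⇒≱ (N-mono-< b<a) Na≤Nb)

  n≤N : ∀ k → k ≤ N k
  n≤N k = ≤-trans (m≤m+n k _) (≤-reflexive (sym (N-unfold k)))

  *≤⇒≤/ : ∀ {y w} → p * y ≤ w → y ≤ w / p
  *≤⇒≤/ {y} {w} py≤w =
    ≤-trans (≤-reflexive (sym (m*n/n≡m y p))) (/-monoˡ-≤ p (≤-trans (≤-reflexive (*-comm y p)) py≤w))

  n<p^n : ∀ n → n < p ^ n
  n<p^n zero = s≤s z≤n
  n<p^n (suc n) = ≤-<-trans (n<p^n n) (^-monoʳ-< p 1<p (n<1+n n))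

  -- θ d = 1 + p + ⋯ + pᵈ is the number of points of the projective space PG(d, p).
  θ : ℕ → ℕ
  θ zero = 1
  θ (suc d) = θ d + p ^ suc d

  θ-suc : ∀ d → θ (suc d) ≡ p * θ d + 1
  θ-suc zero = +-comm 1 (p * 1)
  θ-suc (suc d) = begin
    θ (suc d) + p ^ suc (suc d)       ≡⟨ cong (_+ p ^ suc (suc d)) (θ-suc d) ⟩
    p * θ d + 1 + p * p ^ suc d       ≡⟨ regroup p (θ d) (p ^ suc d) ⟩
    p * (θ d + p ^ suc d) + 1         ∎
    where
    open ≡-Reasoning
    regroup : ∀ p t s → p * t + 1 + p * s ≡ p * (t + s) + 1
    regroup = solve-∀

  sum-map-θ-suc : ∀ B → List.sum (map (θ ∘ suc) B) ≡ p * List.sum (map θ B) + length B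
  sum-map-θ-suc [] = sym (cong (_+ 0) (*-zeroʳ p))
  sum-map-θ-suc (i ∷ B) = begin
    θ (suc i) + List.sum (map (θ ∘ suc) B)        ≡⟨ cong₂ _+_ (θ-suc i) (sum-map-θ-suc B) ⟩
    p * θ i + 1 + (p * List.sum (map θ B) + length B) ≡⟨ regroup p (θ i) (List.sum (map θ B)) (length B) ⟩
    p * (θ i + List.sum (map θ B)) + suc (length B) ∎
    where
    open ≡-Reasoning
    regroup : ∀ p t s l → p * t + 1 + (p * s + l) ≡ p * (t + s) + (1 + l)
    regroup = solve-∀

  -- The exponent i occurs in digits-fuel f k as often as the i-th base-p digit of k, once the fuel f ≥ k.
  digits-fuel : ℕ → ℕ → List ℕ
  digits-fuel zero k = []
  digits-fuel (suc f) k = replicate (k % p) 0 ++ map suc (digits-fuel f (k / p))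

  digits : ℕ → List ℕ
  digits k = digits-fuel k k

  digit-decomposition : ∀ k → k ≡ k % p + p * (k / p)
  digit-decomposition k = trans (m≡m%n+[m/n]*n k p) (cong (k % p +_) (*-comm (k / p) p))

  sum-map-p^-digits : ∀ f k → k ≤ f → List.sum (map (p ^_) (digits-fuel f k)) ≡ k
  sum-map-p^-digits zero .zero z≤n = refl
  sum-map-p^-digits (suc f) k k≤1+f = begin
    List.sum (map (p ^_) (replicate (k % p) 0 ++ map suc (digits-fuel f (k / p))))
      ≡⟨ sum-map-digit-step (p ^_) (k % p) (digits-fuel f (k / p)) ⟩
    k % p * 1 + List.sum (map (λ i → p * p ^ i) (digits-fuel f (k / p)))
      ≡⟨ cong₂ _+_ (*-identityʳ (k % p)) (sum-map-*ˡ p (p ^_) (digits-fuel f (k / p))) ⟩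
    k % p + p * List.sum (map (p ^_) (digits-fuel f (k / p)))
      ≡⟨ cong (λ z → k % p + p * z) (sum-map-p^-digits f (k / p) (/p-≤ k≤1+f)) ⟩
    k % p + p * (k / p)
      ≡⟨ digit-decomposition k ⟨
    k ∎
    where open ≡-Reasoning

  -- Legendre's formula in disguise: (p - 1) N k + (digit sum of k) = p k.
  length-digits : ∀ f k → k ≤ f → p * N k + length (digits-fuel f k) ≡ p * k + N k
  length-digits zero .zero z≤n = refl
  length-digits (suc f) k k≤1+f = begin
    p * N k + length (replicate r 0 ++ map suc B)
      ≡⟨ cong₂ (λ u l → p * u + l) (N-unfold k)
               (trans (length-++ (replicate r 0)) (cong₂ _+_ (length-replicate r) (length-map suc B))) ⟩
    p * (k + N (k / p)) + (r + length B)
      ≡⟨ regroup₁ p k (N (k / p)) r (length B) ⟩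
    p * k + r + (p * N (k / p) + length B)
      ≡⟨ cong (p * k + r +_) (length-digits f (k / p) (/p-≤ k≤1+f)) ⟩
    p * k + r + (p * (k / p) + N (k / p))
      ≡⟨ regroup₂ (p * k) r (p * (k / p)) (N (k / p)) ⟩
    p * k + (r + p * (k / p) + N (k / p))
      ≡⟨ cong (λ z → p * k + (z + N (k / p))) (digit-decomposition k) ⟨
    p * k + (k + N (k / p))
      ≡⟨ cong (p * k +_) (N-unfold k) ⟨
    p * k + N k ∎
    where
    open ≡-Reasoning
    r = k % p
    B = digits-fuel f (k / p)
    regroup₁ : ∀ p k n r l → p * (k + n) + (r + l) ≡ p * k + r + (p * n + l)
    regroup₁ = solve-∀
    regroup₂ : ∀ a r b n → a + r + (b + n) ≡ a + (r + b + n)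
    regroup₂ = solve-∀

  sum-map-θ-digits : ∀ f k → k ≤ f → List.sum (map θ (digits-fuel f k)) ≡ N k
  sum-map-θ-digits zero .zero z≤n = refl
  sum-map-θ-digits (suc f) k k≤1+f = begin
    List.sum (map θ (replicate (k % p) 0 ++ map suc B))
      ≡⟨ sum-map-digit-step θ (k % p) B ⟩
    k % p * 1 + List.sum (map (θ ∘ suc) B)
      ≡⟨ cong₂ _+_ (*-identityʳ (k % p)) (sum-map-θ-suc B) ⟩
    k % p + (p * List.sum (map θ B) + length B)
      ≡⟨ cong (λ z → k % p + (p * z + length B)) (sum-map-θ-digits f (k / p) k/p≤f) ⟩
    k % p + (p * N (k / p) + length B)
      ≡⟨ cong (k % p +_) (length-digits f (k / p) k/p≤f) ⟩
    k % p + (p * (k / p) + N (k / p))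
      ≡⟨ +-assoc (k % p) _ _ ⟨
    k % p + p * (k / p) + N (k / p)
      ≡⟨ cong (_+ N (k / p)) (digit-decomposition k) ⟨
    k + N (k / p)
      ≡⟨ N-unfold k ⟨
    N k ∎
    where
    open ≡-Reasoning
    B = digits-fuel f (k / p)
    k/p≤f = /p-≤ k≤1+f

  Threshold : ℕ → ℕ → Set
  Threshold n t = ∀ j → j < t ⇔ N j < n

  threshold-≤ : ∀ {n t} → Threshold n t → t ≤ n
  threshold-≤ {n} th = ≮⇒≥ (λ n<t → <⇒≱ (Equivalence.to (th n) n<t) (n≤N n))

  threshold-upper : ∀ {n t} → Threshold n t → n ≤ N t
  threshold-upper {t = t} th = ≮⇒≥ (λ Nt<n → <-irrefl refl (Equivalence.from (th t) Nt<n))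

  threshold-lower : ∀ {n t} → 1 ≤ n → Threshold n t → N (pred t) < n
  threshold-lower {t = zero} 1≤n th = contradiction (≤-trans 1≤n (threshold-upper th)) λ ()
  threshold-lower {t = suc t} _ th = Equivalence.to (th t) ≤-refl

  N+≤-below : ∀ {m t} q → N (pred t) < m → q * p < t → N q + t ≤ m
  N+≤-below {m} {suc t} q lo qp<1+t = begin
    N q + suc t         ≡⟨ +-suc (N q) t ⟩
    suc (N q + t)       ≤⟨ s≤s (+-monoˡ-≤ t (N-mono-≤ q≤t/p)) ⟩
    suc (N (t / p) + t) ≡⟨ cong suc (trans (+-comm _ t) (sym (N-unfold t))) ⟩
    suc (N t)           ≤⟨ lo ⟩
    m                   ∎
    where
    open ≤-Reasoning
    q≤t/p : q ≤ t / p
    q≤t/p = ≤-trans (≤-reflexive (sym (m*n/n≡m q p))) (/-monoˡ-≤ p (s≤s⁻¹ qp<1+t))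

  N*p≤-above : ∀ {m t} q → m ≤ N t → t ≤ q * p → N q + t ≤ m → N (q * p) ≤ m
  N*p≤-above {m} {t} q hi t≤qp Nq+t≤m = begin
    N (q * p)   ≡⟨ N-*p q ⟩
    q * p + N q ≡⟨ cong (_+ N q) qp≡t ⟩
    t + N q     ≡⟨ +-comm t (N q) ⟩
    N q + t     ≤⟨ Nq+t≤m ⟩
    m           ∎
    where
    open ≤-Reasoning
    Nq≤N[t/p] : N q ≤ N (t / p)
    Nq≤N[t/p] = +-cancelʳ-≤ t (N q) (N (t / p))
      (≤-trans Nq+t≤m (≤-trans hi (≤-reflexive (trans (N-unfold t) (+-comm t _)))))
    qp≡t : q * p ≡ t
    qp≡t = ≤-antisym (≤-trans (*-monoˡ-≤ p (N-cancel-≤ {q} {t / p} Nq≤N[t/p])) (m/n*n≤m t p)) t≤qp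

  -- With t = λ m this reads: q < λ (m + 1 - λ m) iff q p < λ (m + 1).
  N+≤⇔N*p≤ : ∀ {m t} → N (pred t) < m → m ≤ N t → ∀ q → N q + t ≤ m ⇔ N (q * p) ≤ m
  N+≤⇔N*p≤ {m} {t} lo hi q with q * p <? t
  ... | yes qp<t = mk⇔ (λ _ → <⇒≤ (≤-<-trans (N-mono-≤ (<⇒≤pred qp<t)) lo)) (λ _ → N+≤-below q lo qp<t)
  ... | no qp≮t = mk⇔ (N*p≤-above q hi (≮⇒≥ qp≮t))
                      (λ N[qp]≤m → ≤-trans (≤-trans (+-monoʳ-≤ (N q) (≮⇒≥ qp≮t))
                                              (≤-reflexive (trans (+-comm (N q) (q * p)) (sym (N-*p q))))) N[qp]≤m)

  <∸⇔+< : ∀ {a i n} → i ≤ n → a < n ∸ i ⇔ a + i < n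
  <∸⇔+< {a} i≤n = mk⇔ (m≤o∸n⇒m+n≤o (suc a) i≤n) (m+n≤o⇒m≤o∸n (suc a))

  threshold-count : ∀ {n t} b → n ≤ b → Threshold n t → t ≡ sum {b} (λ j → 𝟙 (N (toℕ j) <? n))
  threshold-count {n} {t} b n≤b th = begin
    t                                ≡⟨ count-< b (≤-trans (threshold-≤ th) n≤b) ⟨
    sum {b} (λ j → 𝟙 (toℕ j <? t))   ≡⟨ sum-cong-≗ {b} (λ j → 𝟙-cong (th (toℕ j)) _ _) ⟩
    sum {b} (λ j → 𝟙 (N (toℕ j) <? n)) ∎
    where open ≡-Reasoning

  threshold-blocks : ∀ {n t} b → n ≤ b → p ≤ n → Threshold n t →
                     t ≡ sum {p} (λ i → sum {b} (λ q → 𝟙 (N (toℕ q * p) <? n ∸ toℕ i)))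
  threshold-blocks {n} {t} b n≤b p≤n th = begin
    t                                                    ≡⟨ threshold-count (b * p) (≤-trans n≤b (m≤m*n b p)) th ⟩
    sum {b * p} (λ k → 𝟙 (N (toℕ k) <? n))                ≡⟨ sum-toℕ-blocks b p (λ k → 𝟙 (N k <? n)) ⟩
    sum {p} (λ i → sum {b} (λ q → 𝟙 (N (toℕ q * p + toℕ i) <? n)))
      ≡⟨ sum-cong-≗ {p} (λ i → sum-cong-≗ {b} (λ q → 𝟙-cong (block⇔ i q) _ _)) ⟩
    sum {p} (λ i → sum {b} (λ q → 𝟙 (N (toℕ q * p) <? n ∸ toℕ i))) ∎
    where
    open ≡-Reasoning
    block⇔ : ∀ (i : Fin p) (q : Fin b) → N (toℕ q * p + toℕ i) < n ⇔ N (toℕ q * p) < n ∸ toℕ i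
    block⇔ i q = subst (λ z → z < n ⇔ N (toℕ q * p) < n ∸ toℕ i)
                   (sym (N-block (toℕ q) (toℕ<n i)))
                   (⇔-sym (<∸⇔+< (≤-trans (<⇒≤ (toℕ<n i)) p≤n)))

  threshold-shift : ∀ {m t s} b → 1 ≤ m → m < b → Threshold m t → Threshold (suc m ∸ t) s →
                    s ≡ sum {b} (λ q → 𝟙 (N (toℕ q * p) <? suc m))
  threshold-shift {m} {t} {s} b 1≤m m<b th ths = begin
    s                                            ≡⟨ threshold-count b (≤-trans (m∸n≤m (suc m) t) m<b) ths ⟩
    sum {b} (λ q → 𝟙 (N (toℕ q) <? suc m ∸ t))   ≡⟨ sum-cong-≗ {b} (λ q → 𝟙-cong (shift⇔ (toℕ q)) _ _) ⟩
    sum {b} (λ q → 𝟙 (N (toℕ q * p) <? suc m))   ∎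
    where
    open ≡-Reasoning
    shift⇔ : ∀ q → N q < suc m ∸ t ⇔ N (q * p) < suc m
    shift⇔ q = ⇔-trans (<∸⇔+< (m≤n⇒m≤1+n (threshold-≤ th)))
                 (⇔-trans (mk⇔ s≤s⁻¹ s≤s)
                 (⇔-trans (N+≤⇔N*p≤ (threshold-lower 1≤m th) (threshold-upper th) q) (mk⇔ s≤s s≤s⁻¹)))

  recurrence : (lam : ℕ → ℕ) → (∀ n → 1 ≤ n → Threshold n (lam n)) →
               ∀ n → p + 1 ≤ n → lam n ≡ sum {p} (λ i → lam (n ∸ suc (toℕ i) + 1 ∸ lam (n ∸ suc (toℕ i))))
  recurrence lam lam-threshold n p+1≤n = begin
    lam n
      ≡⟨ threshold-blocks n ≤-refl p≤n (lam-threshold n 1≤n) ⟩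
    sum {p} (λ i → sum {n} (λ q → 𝟙 (N (toℕ q * p) <? n ∸ toℕ i)))
      ≡⟨ sum-cong-≗ {p} term ⟨
    sum {p} (λ i → lam (n ∸ suc (toℕ i) + 1 ∸ lam (n ∸ suc (toℕ i)))) ∎
    where
    open ≡-Reasoning
    p≤n : p ≤ n
    p≤n = ≤-trans (m≤m+n p 1) p+1≤n
    1≤n : 1 ≤ n
    1≤n = ≤-trans (m≤n+m 1 p) p+1≤n
    term : ∀ i → lam (n ∸ suc (toℕ i) + 1 ∸ lam (n ∸ suc (toℕ i)))
                 ≡ sum {n} (λ q → 𝟙 (N (toℕ q * p) <? n ∸ toℕ i))
    term i = begin
      lam (m + 1 ∸ lam m)                         ≡⟨ cong (λ z → lam (z ∸ lam m)) (+-comm m 1) ⟩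
      lam (suc m ∸ lam m)                         ≡⟨ threshold-shift n 1≤m m<n (lam-threshold m 1≤m)
                                                       (lam-threshold (suc m ∸ lam m) 1≤1+m∸lam) ⟩
      sum {n} (λ q → 𝟙 (N (toℕ q * p) <? suc m))  ≡⟨ cong (λ z → sum {n} (λ q → 𝟙 (N (toℕ q * p) <? z))) n∸i≡1+m ⟨
      sum {n} (λ q → 𝟙 (N (toℕ q * p) <? n ∸ toℕ i)) ∎
      where
      m = n ∸ suc (toℕ i)
      2+i≤n : 2 + toℕ i ≤ n
      2+i≤n = ≤-trans (≤-trans (s≤s (toℕ<n i)) (≤-reflexive (+-comm 1 p))) p+1≤n
      1≤m : 1 ≤ m
      1≤m = m+n≤o⇒m≤o∸n 1 2+i≤n
      m<n : m < n
      m<n = ∸-monoʳ-< z<s (≤-trans (n≤1+n _) 2+i≤n)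
      n∸i≡1+m : n ∸ toℕ i ≡ suc m
      n∸i≡1+m = +-∸-assoc 1 (≤-trans (n≤1+n _) 2+i≤n)
      1≤1+m∸lam : 1 ≤ suc m ∸ lam m
      1≤1+m∸lam = m+n≤o⇒m≤o∸n 1 (s≤s (threshold-≤ (lam-threshold m 1≤m)))

-- Arithmetic modulo a prime

module Congruence (p : ℕ) .{{_ : NonZero p}} where

  infix 4 _≡ₘ_
  record _≡ₘ_ (x y : ℕ) : Set where
    constructor mod-≡
    field %-≡ : x % p ≡ y % p

  ≡ₘ-reflexive : ∀ {x y} → x ≡ y → x ≡ₘ y
  ≡ₘ-reflexive x≡y = mod-≡ (cong (_% p) x≡y)

  ≡ₘ-refl : ∀ {x} → x ≡ₘ x
  ≡ₘ-refl = ≡ₘ-reflexive refl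

  ≡ₘ-sym : ∀ {x y} → x ≡ₘ y → y ≡ₘ x
  ≡ₘ-sym (mod-≡ e) = mod-≡ (sym e)

  ≡ₘ-trans : ∀ {x y z} → x ≡ₘ y → y ≡ₘ z → x ≡ₘ z
  ≡ₘ-trans (mod-≡ e) (mod-≡ e′) = mod-≡ (trans e e′)

  %-≡ₘ : ∀ x → x % p ≡ₘ x
  %-≡ₘ x = mod-≡ (m%n%n≡m%n x p)

  +-congₘ : ∀ {a b c d} → a ≡ₘ b → c ≡ₘ d → a + c ≡ₘ b + d
  +-congₘ {a} {b} {c} {d} (mod-≡ e) (mod-≡ e′) = mod-≡ (begin
    (a + c) % p           ≡⟨ %-distribˡ-+ a c p ⟩
    (a % p + c % p) % p   ≡⟨ cong₂ (λ u v → (u + v) % p) e e′ ⟩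
    (b % p + d % p) % p   ≡⟨ %-distribˡ-+ b d p ⟨
    (b + d) % p           ∎)
    where open ≡-Reasoning

  *-congₘ : ∀ {a b c d} → a ≡ₘ b → c ≡ₘ d → a * c ≡ₘ b * d
  *-congₘ {a} {b} {c} {d} (mod-≡ e) (mod-≡ e′) = mod-≡ (begin
    (a * c) % p           ≡⟨ %-distribˡ-* a c p ⟩
    (a % p * (c % p)) % p ≡⟨ cong₂ (λ u v → (u * v) % p) e e′ ⟩
    (b % p * (d % p)) % p ≡⟨ %-distribˡ-* b d p ⟨
    (b * d) % p           ∎)
    where open ≡-Reasoning

  sum-congₘ : ∀ {n} {f g : Fin n → ℕ} → (∀ i → f i ≡ₘ g i) → sum f ≡ₘ sum g
  sum-congₘ {zero} _ = ≡ₘ-refl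
  sum-congₘ {suc n} f≡g = +-congₘ (f≡g fzero) (sum-congₘ (f≡g ∘ fsuc))

  ∣-respₘ : ∀ {x y} → x ≡ₘ y → p ∣ x → p ∣ y
  ∣-respₘ {x} {y} (mod-≡ e) p∣x = m%n≡0⇒n∣m y p (trans (sym e) (n∣m⇒m%n≡0 x p p∣x))

  ∣⇒≡ₘ0 : ∀ {x} → p ∣ x → x ≡ₘ 0
  ∣⇒≡ₘ0 {x} p∣x = mod-≡ (trans (n∣m⇒m%n≡0 x p p∣x) (sym (m*n%n≡0 0 p)))

∣-<⇒≡0 : ∀ {p d} → d < p → p ∣ d → d ≡ 0
∣-<⇒≡0 {d = zero} _ _ = refl
∣-<⇒≡0 {d = suc d} d<p p∣d = contradiction p∣d (>⇒∤ d<p)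

linear-root-unique-≤ : ∀ {p E D α β} → Prime p → ¬ p ∣ D → β < p → α ≤ β →
                       p ∣ E + α * D → p ∣ E + β * D → β ≤ α
linear-root-unique-≤ {p} {E} {D} {α} {β} pp p∤D β<p α≤β p∣E+αD p∣E+βD =
  [ (λ p∣β∸α → m∸n≡0⇒m≤n (∣-<⇒≡0 (≤-<-trans (m∸n≤m β α) β<p) p∣β∸α)) , (λ p∣D → contradiction p∣D p∤D) ]′
  (euclidsLemma (β ∸ α) D pp (∣m+n∣m⇒∣n (subst (p ∣_) split p∣E+βD) p∣E+αD))
  where
  split : E + β * D ≡ (E + α * D) + (β ∸ α) * D
  split = begin
    E + β * D                 ≡⟨ cong (λ b → E + b * D) (m+[n∸m]≡n α≤β) ⟨
    E + (α + (β ∸ α)) * D     ≡⟨ cong (E +_) (*-distribʳ-+ D α (β ∸ α)) ⟩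
    E + (α * D + (β ∸ α) * D) ≡⟨ +-assoc E _ _ ⟨
    (E + α * D) + (β ∸ α) * D ∎
    where open ≡-Reasoning

linear-root-unique : ∀ {p E D α β} → Prime p → ¬ p ∣ D → α < p → β < p →
                     p ∣ E + α * D → p ∣ E + β * D → α ≡ β
linear-root-unique pp p∤D α<p β<p p∣α p∣β with ≤-total _ _
... | inj₁ α≤β = ≤-antisym α≤β (linear-root-unique-≤ pp p∤D β<p α≤β p∣α p∣β)
... | inj₂ β≤α = ≤-antisym (linear-root-unique-≤ pp p∤D α<p β≤α p∣β p∣α) β≤α

HasArgmax : Set → Set
HasArgmax A = (g : A → ℕ) → ∃ λ i → ∀ j → g j ≤ g i

Fin-argmax : ∀ k → HasArgmax (Fin (suc k))
Fin-argmax zero g = fzero , λ { fzero → ≤-refl }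
Fin-argmax (suc k) g with Fin-argmax k (g ∘ fsuc)
... | i , max-i with ≤-total (g fzero) (g (fsuc i))
...   | inj₁ ≤i = fsuc i , λ { fzero → ≤i ; (fsuc j) → max-i j }
...   | inj₂ i≤ = fzero , λ { fzero → ≤-refl ; (fsuc j) → ≤-trans (max-i j) i≤ }

Vector-argmax : ∀ {A} → HasArgmax A → ∀ m (h : Vector A m → ℕ) →
                (∀ {a a′} → a ≗ a′ → h a ≡ h a′) → ∃ λ b → ∀ a → h a ≤ h b
Vector-argmax A-argmax zero h h-cong = (λ ()) , λ a → ≤-reflexive (h-cong (λ ()))
Vector-argmax {A} A-argmax (suc m) h h-cong = t V.∷ best t , bound
  where
  argmax-tail : ∀ s → ∃ λ b → ∀ u → h (s V.∷ u) ≤ h (s V.∷ b)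
  argmax-tail s = Vector-argmax A-argmax m (λ u → h (s V.∷ u))
                    (λ u≗u′ → h-cong λ { fzero → refl ; (fsuc i) → u≗u′ i })
  best : A → Vector A m
  best s = proj₁ (argmax-tail s)
  t : A
  t = proj₁ (A-argmax (λ s → h (s V.∷ best s)))
  bound : ∀ a → h a ≤ h (t V.∷ best t)
  bound a = begin
    h a                              ≡⟨ h-cong (λ { fzero → refl ; (fsuc i) → refl }) ⟩
    h (V.head a V.∷ V.tail a)        ≤⟨ proj₂ (argmax-tail (V.head a)) (V.tail a) ⟩
    h (V.head a V.∷ best (V.head a)) ≤⟨ proj₂ (A-argmax (λ s → h (s V.∷ best s))) (V.head a) ⟩
    h (t V.∷ best t)                 ∎
    where open ≤-Reasoning

module _ {A : Set} where

  infixr 5 _++ᵥ_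
  _++ᵥ_ : ∀ {m n} → Vector A m → Vector A n → Vector A (m + n)
  _++ᵥ_ {zero} u v = v
  _++ᵥ_ {suc m} u v = V.head u V.∷ (V.tail u ++ᵥ v)

  takeᵥ : ∀ m {n} → Vector A (m + n) → Vector A m
  takeᵥ m a = a ∘ (_↑ˡ _)

  dropᵥ : ∀ m {n} → Vector A (m + n) → Vector A n
  dropᵥ m a = a ∘ (m ↑ʳ_)

  take-++-drop : ∀ m {n} (a : Vector A (m + n)) → a ≗ takeᵥ m a ++ᵥ dropᵥ m a
  take-++-drop zero a i = refl
  take-++-drop (suc m) a fzero = refl
  take-++-drop (suc m) a (fsuc i) = take-++-drop m (V.tail a) i

  ++ᵥ-↑ˡ : ∀ {m n} (u : Vector A m) (v : Vector A n) i → (u ++ᵥ v) (i ↑ˡ n) ≡ u i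
  ++ᵥ-↑ˡ u v fzero = refl
  ++ᵥ-↑ˡ u v (fsuc i) = ++ᵥ-↑ˡ (V.tail u) v i

  ++ᵥ-↑ʳ : ∀ {m n} (u : Vector A m) (v : Vector A n) j → (u ++ᵥ v) (m ↑ʳ j) ≡ v j
  ++ᵥ-↑ʳ {zero} u v j = refl
  ++ᵥ-↑ʳ {suc m} u v j = ++ᵥ-↑ʳ (V.tail u) v j

module Codes {q : ℕ} (pp : Prime (2 + q)) where

  p : ℕ
  p = 2 + q

  open Congruence p
  open FloorSum p (s≤s (s≤s z≤n))

  F : Set
  F = Fin p

  0ᵥ : ∀ {m} → Vector F m
  0ᵥ _ = fzero

  -- The scalar product is computed in ℕ; only its residue modulo p is ever inspected.
  infix 7 _·_
  _·_ : ∀ {m} → Vector F m → Vector F m → ℕ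
  a · x = sum (λ i → toℕ (a i) * toℕ (x i))

  ·-congˡ : ∀ {m} {a a′ : Vector F m} → a ≗ a′ → ∀ x → a · x ≡ a′ · x
  ·-congˡ a≗a′ x = sum-cong-≗ (λ i → cong (λ z → toℕ z * toℕ (x i)) (a≗a′ i))

  0ᵥ-· : ∀ {m} (x : Vector F m) → 0ᵥ · x ≡ 0
  0ᵥ-· {m} x = sum-replicate-zero m

  ·-0ᵥ : ∀ {m} (a : Vector F m) → a · 0ᵥ ≡ 0
  ·-0ᵥ {m} a = trans (sum-cong-≗ (λ i → *-zeroʳ (toℕ (a i)))) (sum-replicate-zero m)

  toℕ-mod : ∀ k → toℕ (k mod p) ≡ₘ k
  toℕ-mod k = ≡ₘ-trans (≡ₘ-reflexive (toℕ-fromℕ< (m%n<n k p))) (%-≡ₘ k)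

  infixl 6 _+[_]_
  _+[_]_ : ∀ {m} → Vector F m → F → Vector F m → Vector F m
  (a +[ α ] b) i = (toℕ (a i) + toℕ α * toℕ (b i)) mod p

  ·-+[] : ∀ {m} (a b : Vector F m) α x → (a +[ α ] b) · x ≡ₘ a · x + toℕ α * (b · x)
  ·-+[] a b α x = ≡ₘ-trans (sum-congₘ termwise) (≡ₘ-reflexive (begin
    sum (λ i → toℕ (a i) * toℕ (x i) + toℕ α * (toℕ (b i) * toℕ (x i)))
      ≡⟨ ∑-distrib-+ (λ i → toℕ (a i) * toℕ (x i)) (λ i → toℕ α * (toℕ (b i) * toℕ (x i))) ⟩
    a · x + sum (λ i → toℕ α * (toℕ (b i) * toℕ (x i)))
      ≡⟨ cong (a · x +_) (sum-*ˡ (toℕ α) (λ i → toℕ (b i) * toℕ (x i))) ⟩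
    a · x + toℕ α * (b · x) ∎))
    where
    open ≡-Reasoning
    termwise : ∀ i → toℕ ((a +[ α ] b) i) * toℕ (x i) ≡ₘ toℕ (a i) * toℕ (x i) + toℕ α * (toℕ (b i) * toℕ (x i))
    termwise i = ≡ₘ-trans (*-congₘ (toℕ-mod (toℕ (a i) + toℕ α * toℕ (b i))) ≡ₘ-refl)
      (≡ₘ-reflexive (trans (*-distribʳ-+ (toℕ (x i)) (toℕ (a i)) (toℕ α * toℕ (b i)))
                           (cong (toℕ (a i) * toℕ (x i) +_) (*-assoc (toℕ α) (toℕ (b i)) (toℕ (x i))))))

  ‖_‖ₚ : ℕ → ℕ
  ‖ e ‖ₚ = 𝟙 (¬? (p ∣? e))

  ‖‖ₚ-cong : ∀ {x y} → x ≡ₘ y → ‖ x ‖ₚ ≡ ‖ y ‖ₚ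
  ‖‖ₚ-cong x≡y = 𝟙-cong (mk⇔ (λ p∤x p∣y → p∤x (∣-respₘ (≡ₘ-sym x≡y) p∣y))
                             (λ p∤y p∣x → p∤y (∣-respₘ x≡y p∣x))) _ _

  ‖‖ₚ-zero : ∀ {e} → p ∣ e → ‖ e ‖ₚ ≡ 0
  ‖‖ₚ-zero {e} p∣e with p ∣? e
  ... | yes _ = refl
  ... | no p∤e = contradiction p∣e p∤e

  ‖‖ₚ-one : ∀ {e} → ¬ p ∣ e → ‖ e ‖ₚ ≡ 1
  ‖‖ₚ-one {e} p∤e with p ∣? e
  ... | yes p∣e = contradiction p∣e p∤e
  ... | no _ = refl

  ‖‖ₚ-≤1 : ∀ e → ‖ e ‖ₚ ≤ 1
  ‖‖ₚ-≤1 e with p ∣? e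
  ... | yes _ = z≤n
  ... | no _ = ≤-refl

  -- A code is given by the list L of columns of its generator matrix G; `wt L a` is the weight of aG.
  wt : ∀ {m} → List (Vector F m) → Vector F m → ℕ
  wt L a = List.sum (map (λ x → ‖ a · x ‖ₚ) L)

  wt-congʳ : ∀ {m} (L : List (Vector F m)) {a a′} → a ≗ a′ → wt L a ≡ wt L a′
  wt-congʳ L a≗a′ = cong List.sum (map-cong (λ x → cong ‖_‖ₚ (·-congˡ a≗a′ x)) L)

  wt-++ : ∀ {m} (L L′ : List (Vector F m)) a → wt (L ++ L′) a ≡ wt L a + wt L′ a
  wt-++ L L′ a = trans (cong List.sum (map-++ _ L L′)) (List.sum-++ (map _ L) _)

  sum-‖‖ₚ-nonzero : ∀ {k} (g : Fin k → ℕ) → (∀ i → ¬ p ∣ g i) → sum (λ i → ‖ g i ‖ₚ) ≡ k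
  sum-‖‖ₚ-nonzero {k} g p∤g = trans (sum-cong-≗ (λ i → ‖‖ₚ-one (p∤g i))) (trans (sum-const k 1) (*-identityʳ k))

  at-most-one-zero : ∀ {k} (g : Fin k → ℕ) → (∀ i j → p ∣ g i → p ∣ g j → i ≡ j) →
                     k ≤ suc (sum (λ i → ‖ g i ‖ₚ))
  at-most-one-zero {zero} g _ = z≤n
  at-most-one-zero {suc k} g unique with p ∣? g fzero
  ... | yes p∣g0 = s≤s (≤-reflexive (sym (sum-‖‖ₚ-nonzero (g ∘ fsuc)
                     (λ i p∣gi → case unique fzero (fsuc i) p∣g0 p∣gi of λ ()))))
  ... | no _ = s≤s (at-most-one-zero (g ∘ fsuc)
                 (λ i j p∣gi p∣gj → Fin.suc-injective (unique (fsuc i) (fsuc j) p∣gi p∣gj)))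

  kernel-column : ∀ {m} (a b x : Vector F m) → p ∣ b · x →
                  sum {p} (λ α → ‖ (a +[ α ] b) · x ‖ₚ) ≡ p * ‖ a · x ‖ₚ
  kernel-column a b x p∣bx =
    trans (sum-cong-≗ (λ α → ‖‖ₚ-cong (≡ₘ-trans (·-+[] a b α x) (vanish α)))) (sum-const p ‖ a · x ‖ₚ)
    where
    vanish : ∀ α → a · x + toℕ α * (b · x) ≡ₘ a · x
    vanish α = ≡ₘ-trans (+-congₘ ≡ₘ-refl (*-congₘ (≡ₘ-refl {toℕ α}) (∣⇒≡ₘ0 p∣bx)))
                        (≡ₘ-reflexive (trans (cong (a · x +_) (*-zeroʳ (toℕ α))) (+-identityʳ _)))

  -- Off the kernel of b, the affine function α ↦ (a + α b)·x has at most one root.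
  off-kernel-column : ∀ {m} (a b x : Vector F m) → ¬ p ∣ b · x →
                      p ≤ suc (sum {p} (λ α → ‖ (a +[ α ] b) · x ‖ₚ))
  off-kernel-column a b x p∤bx = at-most-one-zero _ λ α β p∣α p∣β →
    toℕ-injective (linear-root-unique pp p∤bx (toℕ<n α) (toℕ<n β)
                    (∣-respₘ (·-+[] a b α x) p∣α) (∣-respₘ (·-+[] a b β x) p∣β))

  kernel : ∀ {m} → Vector F m → List (Vector F m) → List (Vector F m)
  kernel b = filter (λ x → p ∣? b · x)

  wt+length-kernel : ∀ {m} (b : Vector F m) L → wt L b + length (kernel b L) ≡ length L
  wt+length-kernel b [] = refl
  wt+length-kernel b (x ∷ L) = case p ∣? b · x of λ where
    (yes p∣bx) → trans (cong₂ (λ u K → u + wt L b + length K) (‖‖ₚ-zero p∣bx) (filter-accept (λ y → p ∣? b · y) p∣bx))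
                       (trans (+-suc (wt L b) _) (cong suc (wt+length-kernel b L)))
    (no p∤bx) → trans (cong₂ (λ u K → u + wt L b + length K) (‖‖ₚ-one p∤bx) (filter-reject (λ y → p ∣? b · y) p∤bx))
                      (cong suc (wt+length-kernel b L))

  weight-average : ∀ {m} (L : List (Vector F m)) a b →
                   p * (wt L b + wt (kernel b L) a) ≤ wt L b + sum {p} (λ α → wt L (a +[ α ] b))
  weight-average [] a b = ≤-trans (≤-reflexive (*-zeroʳ p)) z≤n
  weight-average (x ∷ L) a b = case p ∣? b · x of λ where
      (yes p∣bx) → begin
        p * (‖ b · x ‖ₚ + w + wt (kernel b (x ∷ L)) a)
          ≡⟨ cong₂ (λ u K → p * (u + w + wt K a)) (‖‖ₚ-zero p∣bx) (filter-accept (λ y → p ∣? b · y) p∣bx) ⟩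
        p * (w + (‖ a · x ‖ₚ + z))
          ≡⟨ distribute p w ‖ a · x ‖ₚ z ⟩
        p * ‖ a · x ‖ₚ + p * (w + z)
          ≤⟨ +-monoʳ-≤ (p * ‖ a · x ‖ₚ) (weight-average L a b) ⟩
        p * ‖ a · x ‖ₚ + (w + S)
          ≡⟨ cong (_+ (w + S)) (kernel-column a b x p∣bx) ⟨
        S₀ + (w + S)
          ≡⟨ x∙yz≈y∙xz S₀ w S ⟩
        w + (S₀ + S)
          ≡⟨ cong₂ (λ u v → u + w + v) (‖‖ₚ-zero p∣bx) split-sum ⟨
        ‖ b · x ‖ₚ + w + sum {p} (λ α → ‖ (a +[ α ] b) · x ‖ₚ + wt L (a +[ α ] b)) ∎
      (no p∤bx) → begin
        p * (‖ b · x ‖ₚ + w + wt (kernel b (x ∷ L)) a)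
          ≡⟨ cong₂ (λ u K → p * (u + w + wt K a)) (‖‖ₚ-one p∤bx) (filter-reject (λ y → p ∣? b · y) p∤bx) ⟩
        p * suc (w + z)
          ≡⟨ *-suc p (w + z) ⟩
        p + p * (w + z)
          ≤⟨ +-mono-≤ (off-kernel-column a b x p∤bx) (weight-average L a b) ⟩
        suc S₀ + (w + S)
          ≡⟨ cong suc (x∙yz≈y∙xz S₀ w S) ⟩
        suc (w + (S₀ + S))
          ≡⟨ cong₂ (λ u v → u + w + v) (‖‖ₚ-one p∤bx) split-sum ⟨
        ‖ b · x ‖ₚ + w + sum {p} (λ α → ‖ (a +[ α ] b) · x ‖ₚ + wt L (a +[ α ] b)) ∎
    where
    open ≤-Reasoning
    w = wt L b
    z = wt (kernel b L) a
    S₀ = sum {p} (λ α → ‖ (a +[ α ] b) · x ‖ₚ)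
    S = sum {p} (λ α → wt L (a +[ α ] b))
    split-sum : sum {p} (λ α → ‖ (a +[ α ] b) · x ‖ₚ + wt L (a +[ α ] b)) ≡ S₀ + S
    split-sum = ∑-distrib-+ (λ α → ‖ (a +[ α ] b) · x ‖ₚ) (λ α → wt L (a +[ α ] b))
    distribute : ∀ p w y z → p * (w + (y + z)) ≡ p * y + p * (w + z)
    distribute = solve-∀

  kernel-wt-≤ : ∀ {m} (L : List (Vector F m)) b → (∀ a → wt L a ≤ wt L b) → ∀ a → wt (kernel b L) a ≤ wt L b / p
  kernel-wt-≤ L b b-max a = *≤⇒≤/ (+-cancelˡ-≤ (p * w) (p * wt (kernel b L) a) w (begin
    p * w + p * wt (kernel b L) a        ≡⟨ *-distribˡ-+ p w (wt (kernel b L) a) ⟨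
    p * (w + wt (kernel b L) a)          ≤⟨ weight-average L a b ⟩
    w + sum {p} (λ α → wt L (a +[ α ] b)) ≤⟨ +-monoʳ-≤ w (sum-mono-≤ (λ α → b-max (a +[ α ] b))) ⟩
    w + sum {p} (λ _ → w)                ≡⟨ cong (w +_) (sum-const p w) ⟩
    w + p * w                            ≡⟨ +-comm w (p * w) ⟩
    p * w + w                            ∎))
    where
    open ≤-Reasoning
    w = wt L b

  _≢0ᵥ : ∀ {m} → Vector F m → Set
  x ≢0ᵥ = ∃ λ i → toℕ (x i) ≢ 0

  unit : ∀ {m} → Fin m → Vector F m
  unit fzero = fsuc fzero V.∷ 0ᵥ
  unit (fsuc i) = fzero V.∷ unit i

  unit-· : ∀ {m} (i : Fin m) x → unit i · x ≡ toℕ (x i)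
  unit-· fzero x = trans (cong₂ _+_ (+-identityʳ (toℕ (x fzero))) (0ᵥ-· (V.tail x))) (+-identityʳ _)
  unit-· (fsuc i) x = unit-· i (V.tail x)

  unit-·-∤ : ∀ {m} {x : Vector F m} i → toℕ (x i) ≢ 0 → ¬ p ∣ unit i · x
  unit-·-∤ {x = x} i xi≢0 p∣ = xi≢0 (∣-<⇒≡0 (toℕ<n (x i)) (subst (p ∣_) (unit-· i x) p∣))

  griesmer-fuel : ∀ {m} n (L : List (Vector F m)) → length L ≤ n → All _≢0ᵥ L →
                  ∀ c → (∀ a → wt L a ≤ c) → length L ≤ N c
  griesmer-fuel _ [] _ _ _ _ = z≤n
  griesmer-fuel zero (_ ∷ _) () _ _ _
  griesmer-fuel (suc n) L@(x ∷ _) |L|≤1+n L≢0@((i , xi≢0) ∷ _) c wt≤c = begin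
    length L                ≡⟨ wt+length-kernel b L ⟨
    w + length (kernel b L) ≤⟨ +-monoʳ-≤ w (griesmer-fuel n (kernel b L) |K|≤n (filter⁺ (λ y → p ∣? b · y) L≢0)
                                                         (w / p) (kernel-wt-≤ L b b-max)) ⟩
    w + N (w / p)           ≡⟨ N-unfold w ⟨
    N w                     ≤⟨ N-mono-≤ (wt≤c b) ⟩
    N c                     ∎
    where
    open ≤-Reasoning
    max = Vector-argmax (Fin-argmax (suc q)) _ (wt L) (wt-congʳ L)
    b = proj₁ max
    b-max = proj₂ max
    w = wt L b
    1≤w : 1 ≤ w
    1≤w = ≤-trans (≤-trans (≤-reflexive (sym (‖‖ₚ-one (unit-·-∤ i xi≢0)))) (m≤m+n _ _)) (b-max (unit i))
    |K|≤n : length (kernel b L) ≤ n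
    |K|≤n = s≤s⁻¹ (≤-trans (+-monoˡ-≤ _ 1≤w) (≤-trans (≤-reflexive (wt+length-kernel b L)) |L|≤1+n))

  griesmer : ∀ {m} (L : List (Vector F m)) → All _≢0ᵥ L → ∀ c → (∀ a → wt L a ≤ c) → length L ≤ N c
  griesmer L = griesmer-fuel (length L) L ≤-refl

  -- Bézout gives y with y u ≡ -1 or y u ≡ 1 (mod p); accordingly T ≡ c y or T ≡ (p - 1) c y.
  bezout-root : ∀ c {u} → u < p → u ≢ 0 → ∃ λ T → p ∣ c + u * T
  bezout-root c {u} u<p u≢0 with coprime-Bézout (prime⇒coprime pp {{≢-nonZero u≢0}} u<p)
  ... | Bézout.+- x y 1+yu≡xp = c * y , divides (c * x) (begin
    c + u * (c * y) ≡⟨ factor c u y ⟩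
    c * (1 + y * u) ≡⟨ cong (c *_) 1+yu≡xp ⟩
    c * (x * p)     ≡⟨ *-assoc c x p ⟨
    c * x * p       ∎)
    where
    open ≡-Reasoning
    factor : ∀ c u y → c + u * (c * y) ≡ c * (1 + y * u)
    factor = solve-∀
  ... | Bézout.-+ x y 1+xp≡yu = suc q * c * y , divides (c + suc q * c * x) (begin
    c + u * (suc q * c * y)       ≡⟨ regroup q c u y ⟩
    c + suc q * c * (y * u)       ≡⟨ cong (λ z → c + suc q * c * z) 1+xp≡yu ⟨
    c + suc q * c * (1 + x * p)   ≡⟨ factor q c x ⟩
    (c + suc q * c * x) * p       ∎)
    where
    open ≡-Reasoning
    regroup : ∀ q c u y → c + u * (suc q * c * y) ≡ c + suc q * c * (y * u)
    regroup = solve-∀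
    factor : ∀ q c x → c + suc q * c * (1 + x * (2 + q)) ≡ (c + suc q * c * x) * (2 + q)
    factor = solve-∀

  affine-root : ∀ c (u : F) → toℕ u ≢ 0 → ∃ λ t → p ∣ c + toℕ u * toℕ t
  affine-root c u u≢0 with bezout-root c (toℕ<n u) u≢0
  ... | T , p∣c+uT = T mod p , ∣-respₘ (+-congₘ (≡ₘ-refl {c}) (*-congₘ (≡ₘ-refl {toℕ u}) (≡ₘ-sym (toℕ-mod T)))) p∣c+uT

  sum-‖‖ₚ-with-root : ∀ {k} (g : Fin k → ℕ) t → p ∣ g t → suc (sum (λ i → ‖ g i ‖ₚ)) ≤ k
  sum-‖‖ₚ-with-root {suc k} g fzero p∣g0 = s≤s (begin
    ‖ g fzero ‖ₚ + sum (λ i → ‖ g (fsuc i) ‖ₚ) ≡⟨ cong (_+ sum (λ i → ‖ g (fsuc i) ‖ₚ)) (‖‖ₚ-zero p∣g0) ⟩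
    sum (λ i → ‖ g (fsuc i) ‖ₚ)                 ≤⟨ sum-mono-≤ (λ i → ‖‖ₚ-≤1 (g (fsuc i))) ⟩
    sum {k} (λ _ → 1)                            ≡⟨ trans (sum-const k 1) (*-identityʳ k) ⟩
    k                                            ∎)
    where open ≤-Reasoning
  sum-‖‖ₚ-with-root {suc k} g (fsuc t) p∣gt =
    s≤s (≤-trans (+-monoˡ-≤ (sum (λ i → ‖ g (fsuc i) ‖ₚ)) (‖‖ₚ-≤1 (g fzero))) (sum-‖‖ₚ-with-root (g ∘ fsuc) t p∣gt))

  -- Simplex codes and their direct sums

  ≢0ᵥ? : ∀ {m} (x : Vector F m) → Dec (x ≢0ᵥ)
  ≢0ᵥ? x = any? (λ i → ¬? (toℕ (x i) ≟ 0))

  ¬≢0ᵥ⇒≗0ᵥ : ∀ {m} {x : Vector F m} → ¬ x ≢0ᵥ → x ≗ 0ᵥ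
  ¬≢0ᵥ⇒≗0ᵥ {x = x} x≡0 i = toℕ-injective (decidable-stable (toℕ (x i) ≟ 0) (λ xi≢0 → x≡0 (i , xi≢0)))

  allVectors : ∀ m → List (Vector F m)
  allVectors zero = V.[] ∷ []
  allVectors (suc m) = concat (tabulate λ t → map (t V.∷_) (allVectors m))

  sumᵥ : ∀ m → (Vector F m → ℕ) → ℕ
  sumᵥ m g = List.sum (map g (allVectors m))

  sumᵥ-suc : ∀ m g → sumᵥ (suc m) g ≡ sum {p} (λ t → sumᵥ m (λ y → g (t V.∷ y)))
  sumᵥ-suc m g = begin
    List.sum (map g (concat (tabulate slice)))
      ≡⟨ cong List.sum (concat-map (tabulate slice)) ⟨
    List.sum (concat (map (map g) (tabulate slice)))
      ≡⟨ sum-concat (map (map g) (tabulate slice)) ⟩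
    List.sum (map List.sum (map (map g) (tabulate slice)))
      ≡⟨ cong List.sum (map-∘ {g = List.sum} {f = map g} (tabulate slice)) ⟨
    List.sum (map (List.sum ∘ map g) (tabulate slice))
      ≡⟨ cong List.sum (map-tabulate slice (List.sum ∘ map g)) ⟩
    List.sum (tabulate (List.sum ∘ map g ∘ slice))
      ≡⟨ sum-tabulate (List.sum ∘ map g ∘ slice) ⟩
    sum {p} (λ t → List.sum (map g (map (t V.∷_) (allVectors m))))
      ≡⟨ sum-cong-≗ {p} (λ t → cong List.sum (map-∘ {g = g} {f = t V.∷_} (allVectors m))) ⟨
    sum {p} (λ t → sumᵥ m (λ y → g (t V.∷ y))) ∎
    where
    open ≡-Reasoning
    slice : F → List (Vector F (suc m))
    slice t = map (t V.∷_) (allVectors m)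

  sumᵥ-cong : ∀ m {g h : Vector F m → ℕ} → (∀ y → g y ≡ h y) → sumᵥ m g ≡ sumᵥ m h
  sumᵥ-cong m g≡h = cong List.sum (map-cong g≡h (allVectors m))

  sumᵥ-const : ∀ m c → sumᵥ m (λ _ → c) ≡ p ^ m * c
  sumᵥ-const zero c = refl
  sumᵥ-const (suc m) c = begin
    sumᵥ (suc m) (λ _ → c)              ≡⟨ sumᵥ-suc m (λ _ → c) ⟩
    sum {p} (λ _ → sumᵥ m (λ _ → c))    ≡⟨ sum-cong-≗ {p} (λ _ → sumᵥ-const m c) ⟩
    sum {p} (λ _ → p ^ m * c)           ≡⟨ sum-const p (p ^ m * c) ⟩
    p * (p ^ m * c)                     ≡⟨ *-assoc p (p ^ m) c ⟨
    p ^ suc m * c                       ∎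
    where open ≡-Reasoning

  length-allVectors : ∀ m → length (allVectors m) ≡ p ^ m
  length-allVectors m = trans (length≡sum-map-1 (allVectors m)) (trans (sumᵥ-const m 1) (*-identityʳ (p ^ m)))

  affine-nonzeros-head : ∀ d c (u : Vector F (suc d)) → u ≢0ᵥ → V.tail u ≗ 0ᵥ →
                         p ^ d + sumᵥ (suc d) (λ y → ‖ c + u · y ‖ₚ) ≤ p ^ suc d
  affine-nonzeros-head d c u u≢0 u′≗0 = begin
    p ^ d + sumᵥ (suc d) (λ y → ‖ c + u · y ‖ₚ)
      ≡⟨ cong (p ^ d +_) (sumᵥ-suc d (λ y → ‖ c + u · y ‖ₚ)) ⟩
    p ^ d + sum {p} (λ t → sumᵥ d (λ y → ‖ c + u · (t V.∷ y) ‖ₚ))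
      ≡⟨ cong (p ^ d +_) (sum-cong-≗ {p} λ t →
           trans (sumᵥ-cong d (λ y → cong ‖_‖ₚ (drop-tail t y))) (sumᵥ-const d ‖ c + u₀ * toℕ t ‖ₚ)) ⟩
    p ^ d + sum {p} (λ t → p ^ d * ‖ c + u₀ * toℕ t ‖ₚ)
      ≡⟨ cong (p ^ d +_) (sum-*ˡ {p} (p ^ d) (λ t → ‖ c + u₀ * toℕ t ‖ₚ)) ⟩
    p ^ d + p ^ d * sum {p} (λ t → ‖ c + u₀ * toℕ t ‖ₚ)
      ≡⟨ *-suc (p ^ d) (sum {p} (λ t → ‖ c + u₀ * toℕ t ‖ₚ)) ⟨
    p ^ d * suc (sum {p} (λ t → ‖ c + u₀ * toℕ t ‖ₚ))
      ≤⟨ *-monoʳ-≤ (p ^ d) (sum-‖‖ₚ-with-root (λ t → c + u₀ * toℕ t) (proj₁ root) (proj₂ root)) ⟩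
    p ^ d * p
      ≡⟨ *-comm (p ^ d) p ⟩
    p ^ suc d ∎
    where
    open ≤-Reasoning
    u₀ = toℕ (u fzero)
    drop-tail : ∀ t y → c + u · (t V.∷ y) ≡ c + u₀ * toℕ t
    drop-tail t y = trans (cong (λ z → c + (u₀ * toℕ t + z)) (trans (·-congˡ u′≗0 y) (0ᵥ-· y)))
                          (cong (c +_) (+-identityʳ _))
    head-≢0 : u ≢0ᵥ → u₀ ≢ 0
    head-≢0 (fzero , u₀≢0) = u₀≢0
    head-≢0 (fsuc i , uᵢ≢0) = contradiction (cong toℕ (u′≗0 i)) uᵢ≢0
    root = affine-root c (u fzero) (head-≢0 u≢0)

  -- The zero set of y ↦ c + u·y is an affine hyperplane of 𝔽_p^(d+1), with p^d points.
  affine-nonzeros : ∀ d c (u : Vector F (suc d)) → u ≢0ᵥ →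
                    p ^ d + sumᵥ (suc d) (λ y → ‖ c + u · y ‖ₚ) ≤ p ^ suc d
  affine-nonzeros zero c u u≢0 = affine-nonzeros-head zero c u u≢0 (λ ())
  affine-nonzeros (suc d) c u u≢0 with ≢0ᵥ? (V.tail u)
  ... | no u′≡0 = affine-nonzeros-head (suc d) c u u≢0 (¬≢0ᵥ⇒≗0ᵥ u′≡0)
  ... | yes u′≢0 = begin
    p ^ suc d + sumᵥ (suc (suc d)) (λ y → ‖ c + u · y ‖ₚ)
      ≡⟨ cong₂ _+_ (sym (sum-const p (p ^ d))) (sumᵥ-suc (suc d) (λ y → ‖ c + u · y ‖ₚ)) ⟩
    sum {p} (λ _ → p ^ d) + sum {p} (λ t → sumᵥ (suc d) (λ y → ‖ c + u · (t V.∷ y) ‖ₚ))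
      ≡⟨ ∑-distrib-+ {p} (λ _ → p ^ d) (λ t → sumᵥ (suc d) (λ y → ‖ c + u · (t V.∷ y) ‖ₚ)) ⟨
    sum {p} (λ t → p ^ d + sumᵥ (suc d) (λ y → ‖ c + u · (t V.∷ y) ‖ₚ))
      ≡⟨ sum-cong-≗ {p} (λ t → cong (p ^ d +_) (sumᵥ-cong (suc d) (λ y →
           cong ‖_‖ₚ (+-assoc c (toℕ (u fzero) * toℕ t) (V.tail u · y))))) ⟨
    sum {p} (λ t → p ^ d + sumᵥ (suc d) (λ y → ‖ (c + toℕ (u fzero) * toℕ t) + V.tail u · y ‖ₚ))
      ≤⟨ sum-mono-≤ {p} (λ t → affine-nonzeros d (c + toℕ (u fzero) * toℕ t) (V.tail u) u′≢0) ⟩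
    sum {p} (λ _ → p ^ suc d)
      ≡⟨ sum-const p (p ^ suc d) ⟩
    p ^ suc (suc d) ∎
    where open ≤-Reasoning

  1F : F
  1F = fsuc fzero

  wt-0ᵥ : ∀ {m} (L : List (Vector F m)) → wt L 0ᵥ ≡ 0
  wt-0ᵥ [] = refl
  wt-0ᵥ (x ∷ L) = cong₂ _+_ (cong ‖_‖ₚ (0ᵥ-· x)) (wt-0ᵥ L)

  wt-map-0∷ : ∀ {m} (L : List (Vector F m)) a → wt (map (fzero V.∷_) L) a ≡ wt L (V.tail a)
  wt-map-0∷ L a = trans (cong List.sum (sym (map-∘ L))) (cong List.sum (map-cong drop-head L))
    where
    drop-head : ∀ x → ‖ a · (fzero V.∷ x) ‖ₚ ≡ ‖ V.tail a · x ‖ₚ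
    drop-head x = cong (λ z → ‖ z + V.tail a · x ‖ₚ) (*-zeroʳ (toℕ (a fzero)))

  wt-map-1∷ : ∀ {m} (L : List (Vector F m)) a →
              wt (map (1F V.∷_) L) a ≡ List.sum (map (λ y → ‖ toℕ (a fzero) * 1 + V.tail a · y ‖ₚ) L)
  wt-map-1∷ L a = cong List.sum (sym (map-∘ L))

  -- One column for each point of PG(d, p), normalised to have first nonzero coordinate 1.
  simplex : ∀ d → List (Vector F (suc d))
  simplex zero = (1F V.∷ V.[]) ∷ []
  simplex (suc d) = map (fzero V.∷_) (simplex d) ++ map (1F V.∷_) (allVectors (suc d))

  length-simplex : ∀ d → length (simplex d) ≡ θ d
  length-simplex zero = refl
  length-simplex (suc d) = begin
    length (map (fzero V.∷_) (simplex d) ++ map (1F V.∷_) (allVectors (suc d)))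
      ≡⟨ length-++ (map (fzero V.∷_) (simplex d)) ⟩
    length (map (fzero V.∷_) (simplex d)) + length (map (1F V.∷_) (allVectors (suc d)))
      ≡⟨ cong₂ _+_ (length-map _ (simplex d)) (length-map _ (allVectors (suc d))) ⟩
    length (simplex d) + length (allVectors (suc d))
      ≡⟨ cong₂ _+_ (length-simplex d) (length-allVectors (suc d)) ⟩
    θ (suc d) ∎
    where open ≡-Reasoning

  simplex-≢0ᵥ : ∀ d → All _≢0ᵥ (simplex d)
  simplex-≢0ᵥ zero = (fzero , λ ()) ∷ []
  simplex-≢0ᵥ (suc d) =
    ++⁺ (map⁺ (All.map (λ { (i , xᵢ≢0) → fsuc i , xᵢ≢0 }) (simplex-≢0ᵥ d)))
        (map⁺ (All.universal (λ _ → fzero , λ ()) (allVectors (suc d))))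

  simplex-wt : ∀ d a → wt (simplex d) a ≤ p ^ d
  simplex-wt zero a = ≤-trans (≤-reflexive (+-identityʳ _)) (‖‖ₚ-≤1 _)
  simplex-wt (suc d) a = begin
    wt (map (fzero V.∷_) (simplex d) ++ map (1F V.∷_) (allVectors (suc d))) a
      ≡⟨ wt-++ (map (fzero V.∷_) (simplex d)) _ a ⟩
    wt (map (fzero V.∷_) (simplex d)) a + wt (map (1F V.∷_) (allVectors (suc d))) a
      ≡⟨ cong₂ _+_ (wt-map-0∷ (simplex d) a) (wt-map-1∷ (allVectors (suc d)) a) ⟩
    wt (simplex d) u + sumᵥ (suc d) (λ y → ‖ c + u · y ‖ₚ)
      ≤⟨ split (≢0ᵥ? u) ⟩
    p ^ suc d ∎
    where
    open ≤-Reasoning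
    u = V.tail a
    c = toℕ (a fzero) * 1
    split : Dec (u ≢0ᵥ) → wt (simplex d) u + sumᵥ (suc d) (λ y → ‖ c + u · y ‖ₚ) ≤ p ^ suc d
    split (yes u≢0) =
      ≤-trans (+-monoˡ-≤ (sumᵥ (suc d) (λ y → ‖ c + u · y ‖ₚ)) (simplex-wt d u)) (affine-nonzeros d c u u≢0)
    split (no u≡0) = begin
      wt (simplex d) u + sumᵥ (suc d) (λ y → ‖ c + u · y ‖ₚ)
        ≡⟨ cong (_+ sumᵥ (suc d) (λ y → ‖ c + u · y ‖ₚ))
                (trans (wt-congʳ (simplex d) (¬≢0ᵥ⇒≗0ᵥ u≡0)) (wt-0ᵥ (simplex d))) ⟩
      sumᵥ (suc d) (λ y → ‖ c + u · y ‖ₚ)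
        ≤⟨ sum-map-mono-≤ (λ y → ‖‖ₚ-≤1 (c + u · y)) (allVectors (suc d)) ⟩
      sumᵥ (suc d) (λ _ → 1)
        ≡⟨ trans (sumᵥ-const (suc d) 1) (*-identityʳ _) ⟩
      p ^ suc d ∎

  ++ᵥ-· : ∀ {m n} (a x : Vector F m) (b y : Vector F n) → (a ++ᵥ b) · (x ++ᵥ y) ≡ a · x + b · y
  ++ᵥ-· {zero} a x b y = refl
  ++ᵥ-· {suc m} a x b y = trans (cong (toℕ (a fzero) * toℕ (x fzero) +_) (++ᵥ-· (V.tail a) (V.tail x) b y))
                                (sym (+-assoc (toℕ (a fzero) * toℕ (x fzero)) _ _))

  infixr 5 _⊕_
  _⊕_ : ∀ {m n} → List (Vector F m) → List (Vector F n) → List (Vector F (m + n))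
  L ⊕ L′ = map (_++ᵥ 0ᵥ) L ++ map (0ᵥ ++ᵥ_) L′

  wt-⊕ : ∀ {m n} (L : List (Vector F m)) (L′ : List (Vector F n)) a →
         wt (L ⊕ L′) a ≡ wt L (takeᵥ m a) + wt L′ (dropᵥ m a)
  wt-⊕ {m} L L′ a = begin
    wt (L ⊕ L′) a
      ≡⟨ wt-congʳ (L ⊕ L′) (take-++-drop m a) ⟩
    wt (L ⊕ L′) (a₁ ++ᵥ a₂)
      ≡⟨ wt-++ (map (_++ᵥ 0ᵥ) L) (map (0ᵥ ++ᵥ_) L′) (a₁ ++ᵥ a₂) ⟩
    wt (map (_++ᵥ 0ᵥ) L) (a₁ ++ᵥ a₂) + wt (map (0ᵥ ++ᵥ_) L′) (a₁ ++ᵥ a₂)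
      ≡⟨ cong₂ _+_ (cong List.sum (sym (map-∘ L))) (cong List.sum (sym (map-∘ L′))) ⟩
    List.sum (map (λ x → ‖ (a₁ ++ᵥ a₂) · (x ++ᵥ 0ᵥ) ‖ₚ) L) + List.sum (map (λ y → ‖ (a₁ ++ᵥ a₂) · (0ᵥ ++ᵥ y) ‖ₚ) L′)
      ≡⟨ cong₂ _+_ (cong List.sum (map-cong (λ x → cong ‖_‖ₚ (left x)) L))
                   (cong List.sum (map-cong (λ y → cong ‖_‖ₚ (right y)) L′)) ⟩
    wt L a₁ + wt L′ a₂ ∎
    where
    open ≡-Reasoning
    a₁ = takeᵥ m a
    a₂ = dropᵥ m a
    left : ∀ x → (a₁ ++ᵥ a₂) · (x ++ᵥ 0ᵥ) ≡ a₁ · x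
    left x = trans (++ᵥ-· a₁ x a₂ 0ᵥ) (trans (cong (a₁ · x +_) (·-0ᵥ a₂)) (+-identityʳ _))
    right : ∀ y → (a₁ ++ᵥ a₂) · (0ᵥ ++ᵥ y) ≡ a₂ · y
    right y = trans (++ᵥ-· a₁ 0ᵥ a₂ y) (cong (_+ a₂ · y) (·-0ᵥ a₁))

  length-⊕ : ∀ {m n} (L : List (Vector F m)) (L′ : List (Vector F n)) → length (L ⊕ L′) ≡ length L + length L′
  length-⊕ L L′ = trans (length-++ (map (_++ᵥ 0ᵥ) L)) (cong₂ _+_ (length-map _ L) (length-map _ L′))

  ⊕-≢0ᵥ : ∀ {m n} {L : List (Vector F m)} {L′ : List (Vector F n)} → All _≢0ᵥ L → All _≢0ᵥ L′ → All _≢0ᵥ (L ⊕ L′)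
  ⊕-≢0ᵥ {m} {n} L≢0 L′≢0 =
    ++⁺ (map⁺ (All.map (λ { {x} (i , xᵢ≢0) → i ↑ˡ n , subst (λ z → toℕ z ≢ 0) (sym (++ᵥ-↑ˡ x 0ᵥ i)) xᵢ≢0 }) L≢0))
        (map⁺ (All.map (λ { {y} (j , yⱼ≢0) → m ↑ʳ j , subst (λ z → toℕ z ≢ 0) (sym (++ᵥ-↑ʳ (0ᵥ {m}) y j)) yⱼ≢0 })
                       L′≢0))

  dim : List ℕ → ℕ
  dim [] = 0
  dim (i ∷ B) = suc i + dim B

  simplices : (B : List ℕ) → List (Vector F (dim B))
  simplices [] = []
  simplices (i ∷ B) = simplex i ⊕ simplices B

  length-simplices : ∀ B → length (simplices B) ≡ List.sum (map θ B)
  length-simplices [] = refl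
  length-simplices (i ∷ B) =
    trans (length-⊕ (simplex i) (simplices B)) (cong₂ _+_ (length-simplex i) (length-simplices B))

  wt-simplices : ∀ B a → wt (simplices B) a ≤ List.sum (map (p ^_) B)
  wt-simplices [] a = z≤n
  wt-simplices (i ∷ B) a = ≤-trans (≤-reflexive (wt-⊕ (simplex i) (simplices B) a))
                                   (+-mono-≤ (simplex-wt i (takeᵥ (suc i) a)) (wt-simplices B (dropᵥ (suc i) a)))

  simplices-≢0ᵥ : ∀ B → All _≢0ᵥ (simplices B)
  simplices-≢0ᵥ [] = []
  simplices-≢0ᵥ (i ∷ B) = ⊕-≢0ᵥ (simplex-≢0ᵥ i) (simplices-≢0ᵥ B)

  dim-≤ : ∀ B → dim B ≤ List.sum (map (p ^_) B)
  dim-≤ [] = z≤n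
  dim-≤ (i ∷ B) = +-mono-≤ (n<p^n i) (dim-≤ B)

  columns : ∀ {m n} → Matrix pp m n → List (Vector F m)
  columns M = tabulate (λ j i → M i j)

  fromColumns : ∀ {m} (L : List (Vector F m)) → Matrix pp m (length L)
  fromColumns L i j = lookup L j i

  weight≡sum : ∀ {n} (v : Vector F n) → weight pp v ≡ sum (λ j → 𝟙 (¬? (toℕ (v j) ≟ 0)))
  weight≡sum {n} v = trans (length-filter-𝟙 (λ j → ¬? (toℕ (v j) ≟ 0)) (allFin n))
                           (trans (cong List.sum (map-tabulate id nonzero)) (sum-tabulate nonzero))
    where
    nonzero : Fin n → ℕ
    nonzero j = 𝟙 (¬? (toℕ (v j) ≟ 0))

  weight-cong : ∀ {n} {v v′ : Vector F n} → v ≗ v′ → weight pp v ≡ weight pp v′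
  weight-cong {v = v} {v′} v≗v′ =
    trans (weight≡sum v) (trans (sum-cong-≗ (λ j → cong (λ z → 𝟙 (¬? (toℕ z ≟ 0))) (v≗v′ j))) (sym (weight≡sum v′)))

  𝟙[%≢0]≡‖‖ₚ : ∀ e → 𝟙 (¬? (e % p ≟ 0)) ≡ ‖ e ‖ₚ
  𝟙[%≢0]≡‖‖ₚ e = 𝟙-cong (mk⇔ (λ e%p≢0 p∣e → e%p≢0 (n∣m⇒m%n≡0 e p p∣e))
                               (λ p∤e e%p≡0 → p∤e (m%n≡0⇒n∣m e p e%p≡0))) _ _

  weight-lincomb : ∀ {m n} (M : Matrix pp m n) a → weight pp (lincomb pp M a) ≡ wt (columns M) a
  weight-lincomb {m} {n} M a = begin
    weight pp (lincomb pp M a)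
      ≡⟨ weight≡sum (lincomb pp M a) ⟩
    sum (λ j → 𝟙 (¬? (toℕ (lincomb pp M a j) ≟ 0)))
      ≡⟨ sum-cong-≗ {n} (λ j → trans (cong (λ e → 𝟙 (¬? (e ≟ 0))) (toℕ-lincomb j)) (𝟙[%≢0]≡‖‖ₚ _)) ⟩
    sum (λ j → ‖ a · (λ i → M i j) ‖ₚ)
      ≡⟨ sum-tabulate (λ j → ‖ a · (λ i → M i j) ‖ₚ) ⟨
    List.sum (tabulate (λ j → ‖ a · (λ i → M i j) ‖ₚ))
      ≡⟨ cong List.sum (map-tabulate (λ j i → M i j) _) ⟨
    wt (columns M) a ∎
    where
    open ≡-Reasoning
    toℕ-lincomb : ∀ j → toℕ (lincomb pp M a j) ≡ (a · (λ i → M i j)) % p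
    toℕ-lincomb j = trans (toℕ-fromℕ< _) (cong (_% p) (∑≡sum m (λ i → toℕ (a i) * toℕ (M i j))))

  capacity-bound : ∀ {m n} {M : Matrix pp m n} {c} → IsCapacity pp M c → ∀ a → wt (columns M) a ≤ c
  capacity-bound {M = M} (_ , max) a = subst (_≤ _) (weight-lincomb M a) (max (lincomb pp M a) (a , λ _ → refl))

  capacity-of-max : ∀ {m n} (M : Matrix pp m n) b → (∀ a → wt (columns M) a ≤ wt (columns M) b) →
                    IsCapacity pp M (wt (columns M) b)
  capacity-of-max M b b-max =
    (lincomb pp M b , (b , λ _ → refl) , weight-lincomb M b) ,
    λ { v (a , a≡v) → ≤-trans (≤-reflexive (trans (weight-cong (λ j → sym (a≡v j))) (weight-lincomb M a))) (b-max a) }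

  griesmer-matrix : ∀ {m n} (M : Matrix pp m n) → NoZeroColumn pp M → ∀ {c} → IsCapacity pp M c → n ≤ N c
  griesmer-matrix {n = n} M no-zero-column {c} cap =
    subst (_≤ N c) (length-tabulate _) (griesmer (columns M) (tabulate⁺ no-zero-column) c (capacity-bound cap))

  matrix-of-columns : ∀ {m n k} (L : List (Vector F m)) → length L ≡ n → 1 ≤ n → m ≤ p ^ n → All _≢0ᵥ L →
                      (∀ a → wt L a ≤ k) →
                      Σ (Matrix pp m n) λ M → InMStar pp m n M × ∃ λ c → IsCapacity pp M c × c ≤ k
  matrix-of-columns [] refl () _ _ _
  matrix-of-columns {k = k} L@(_ ∷ _) refl _ m≤p^n L≢0@((i , _) ∷ _) wt≤k =
    M , (>-nonZero⁻¹ _ {{Fin.nonZeroIndex i}} , m≤p^n , λ j → All.lookup L≢0 (∈-lookup j)) ,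
    wt (columns M) b , capacity-of-max M b b-max , subst (λ L′ → wt L′ b ≤ k) (sym (tabulate-lookup L)) (wt≤k b)
    where
    M = fromColumns L
    max = Vector-argmax (Fin-argmax (suc q)) _ (wt (columns M)) (wt-congʳ (columns M))
    b = proj₁ max
    b-max = proj₂ max

  simplex-sum-matrix : ∀ {n k} → 1 ≤ n → n ≤ N k → k ≤ n →
                       ∃ λ m → Σ (Matrix pp m n) λ M → InMStar pp m n M × ∃ λ c → IsCapacity pp M c × c ≤ k
  simplex-sum-matrix {n} {k} 1≤n n≤Nk k≤n =
    dim B , matrix-of-columns (take n L) |take| 1≤n dim≤p^n (take⁺ n (simplices-≢0ᵥ B)) wt≤k
    where
    B = digits k
    L = simplices B
    Σp^B≡k : List.sum (map (p ^_) B) ≡ k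
    Σp^B≡k = sum-map-p^-digits k k ≤-refl
    |take| : length (take n L) ≡ n
    |take| = trans (length-take n L)
               (trans (cong (n ⊓_) (trans (length-simplices B) (sum-map-θ-digits k k ≤-refl))) (m≤n⇒m⊓n≡m n≤Nk))
    dim≤p^n : dim B ≤ p ^ n
    dim≤p^n = ≤-trans (dim-≤ B) (≤-trans (≤-reflexive Σp^B≡k) (≤-trans k≤n (<⇒≤ (n<p^n n))))
    wt≤k : ∀ a → wt (take n L) a ≤ k
    wt≤k a = begin
      List.sum (map (λ x → ‖ a · x ‖ₚ) (take n L)) ≡⟨ cong List.sum (take-map n L) ⟨
      List.sum (take n (map (λ x → ‖ a · x ‖ₚ) L)) ≤⟨ sum-take-≤ n _ ⟩
      wt L a                                       ≤⟨ wt-simplices B a ⟩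
      List.sum (map (p ^_) B)                      ≡⟨ Σp^B≡k ⟩
      k                                            ∎
      where open ≤-Reasoning

  lambda-≤ : ∀ {n k t} → 1 ≤ n → n ≤ N k → IsLambda pp n t → t ≤ k
  lambda-≤ {n} {k} {t} 1≤n n≤Nk (_ , minimal) =
    [ below n≤Nk , (λ n≤k → ≤-trans (below (n≤N n) ≤-refl) n≤k) ]′ (≤-total k n)
    where
    below : ∀ {k} → n ≤ N k → k ≤ n → t ≤ k
    below n≤Nk k≤n with simplex-sum-matrix 1≤n n≤Nk k≤n
    ... | m , M , M∈𝓜 , c , cap , c≤k = ≤-trans (minimal m M M∈𝓜 c cap) c≤k

  lambda-threshold : ∀ {n t} → 1 ≤ n → IsLambda pp n t → Threshold n t
  lambda-threshold {n} {t} 1≤n isλ@((_ , M , (_ , _ , no-zero-column) , cap) , _) j = mk⇔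
    (λ j<t → ≰⇒> (λ n≤Nj → <⇒≱ j<t (lambda-≤ 1≤n n≤Nj isλ)))
    (λ Nj<n → ≰⇒> (λ t≤j → <⇒≱ Nj<n (≤-trans (griesmer-matrix M no-zero-column cap) (N-mono-≤ t≤j))))

corollary2p8 : (p : ℕ) (pp : Prime p) (lam : ℕ → ℕ)
    → (∀ n → 1 ≤ n → IsLambda pp n (lam n))
    → ∀ n → p + 1 ≤ n
    → lam n ≡ ∑ p (λ (i : Fin p) → lam (n ∸ suc (toℕ i) + 1 ∸ lam (n ∸ suc (toℕ i))))
corollary2p8 zero pp = contradiction pp ¬prime[0]
corollary2p8 (suc zero) pp = contradiction pp ¬prime[1]
corollary2p8 (suc (suc q)) pp lam isλ n p+1≤n =
  trans (recurrence lam (λ n 1≤n → lambda-threshold 1≤n (isλ n 1≤n)) n p+1≤n)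
        (sym (∑≡sum (suc (suc q)) (λ i → lam (n ∸ suc (toℕ i) + 1 ∸ lam (n ∸ suc (toℕ i))))))
  where
  open Codes pp using (lambda-threshold)
  open FloorSum (suc (suc q)) (s≤s (s≤s z≤n)) using (recurrence)
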